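{- For every integer $n \geq 4$, the star $K_{1,n-1}$ is not solvable in reversible peg solitaire.
   Context: Reversible peg solitaire on a finite simple graph $G$: a configuration assigns to each vertex either a peg or a hole. If $xyz$ is a path in $G$ (i.e., $x$ is adjacent to $y$ and $y$ is adjacent to $z$, with $x,y,z$ distinct), then a jump is allowed when $x$ and $y$ have pegs and $z$ has a hole: it removes the pegs from $x$ and $y$ and places a peg on $z$. An unjump is the reverse move: when $x$ and $y$ have holes and $z$ has a peg, it removes the peg from $z$ and places pegs on $x$ and $y$. A graph $G$ is solvable if, for some starting configuration with exactly one hole (pegs on all other vertices), some finite sequence of jumps and unjumps produces a configuration with exactly one peg. $K_{1,n-1}$ denotes the star on $n$ vertices. -}

module Defs where

open import Data.Nat using (ℕ; suc)
open import Data.Fin using (Fin; zero; suc)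
open import Data.Bool using (Bool; true; false)
open import Data.Product using (Σ; ∃; _×_; _,_)
open import Data.Sum using (_⊎_)
open import Data.Empty using (⊥)
open import Data.Unit using (⊤; tt)
open import Relation.Nullary using (¬_)
open import Relation.Binary.PropositionalEquality using (_≡_; _≢_)
open import Relation.Binary.Construct.Closure.ReflexiveTransitive using (Star)

record Graph (n : ℕ) : Set₁ where
  field
    Adj   : Fin n → Fin n → Set
    sym   : ∀ {x y} → Adj x y → Adj y x
    irrefl : ∀ {x} → ¬ Adj x x

-- Configurations: true = peg, false = hole.
Config : ℕ → Set
Config n = Fin n → Bool

record Update {n : ℕ} (c c′ : Config n) (x y z : Fin n) (bx by bz : Bool) : Set where
  field
    atx  : c′ x ≡ bx
    aty  : c′ y ≡ by
    atz  : c′ z ≡ bz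
    rest : ∀ v → v ≢ x → v ≢ y → v ≢ z → c′ v ≡ c v

record IsPath {n : ℕ} (G : Graph n) (x y z : Fin n) : Set where
  field
    xy  : Graph.Adj G x y
    yz  : Graph.Adj G y z
    x≢y : x ≢ y
    y≢z : y ≢ z
    x≢z : x ≢ z

Jump : ∀ {n} → Graph n → Config n → Config n → Set
Jump {n} G c c′ = Σ (Fin n) λ x → Σ (Fin n) λ y → Σ (Fin n) λ z →
  IsPath G x y z × c x ≡ true × c y ≡ true × c z ≡ false ×
  Update c c′ x y z false false true

Unjump : ∀ {n} → Graph n → Config n → Config n → Set
Unjump {n} G c c′ = Σ (Fin n) λ x → Σ (Fin n) λ y → Σ (Fin n) λ z →
  IsPath G x y z × c x ≡ false × c y ≡ false × c z ≡ true ×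
  Update c c′ x y z true true false

Move : ∀ {n} → Graph n → Config n → Config n → Set
Move G c c′ = Jump G c c′ ⊎ Unjump G c c′

Reachable : ∀ {n} → Graph n → Config n → Config n → Set
Reachable G = Star (Move G)

oneHole : ∀ {n} → Fin n → Config n → Set
oneHole h c = c h ≡ false × (∀ v → v ≢ h → c v ≡ true)

onePeg : ∀ {n} → Fin n → Config n → Set
onePeg p c = c p ≡ true × (∀ v → v ≢ p → c v ≡ false)

Solvable : ∀ {n} → Graph n → Set
Solvable {n} G = Σ (Fin n) λ h → Σ (Config n) λ c₀ → oneHole h c₀ ×
  Σ (Fin n) λ p → Σ (Config n) λ c₁ → onePeg p c₁ × Reachable G c₀ c₁

StarAdj : ∀ {m} → Fin (suc m) → Fin (suc m) → Set
StarAdj zero    zero    = ⊥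
StarAdj zero    (suc _) = ⊤
StarAdj (suc _) zero    = ⊤
StarAdj (suc _) (suc _) = ⊥

StarAdj-sym : ∀ {m} {x y : Fin (suc m)} → StarAdj x y → StarAdj y x
StarAdj-sym {x = zero}  {y = suc _} _ = tt
StarAdj-sym {x = suc _} {y = zero}  _ = tt

StarAdj-irrefl : ∀ {m} {x : Fin (suc m)} → ¬ StarAdj x x
StarAdj-irrefl {x = zero}  ()
StarAdj-irrefl {x = suc _} ()

-- The star K_{1,m} on the vertex set Fin (suc m) (so it has n = m + 1 vertices).
K1 : (m : ℕ) → Graph (suc m)
K1 m = record { Adj = StarAdj ; sym = StarAdj-sym ; irrefl = StarAdj-irrefl }

-- In the star every path has the centre in the middle, so a jump or unjump along
-- x–centre–z just moves one peg between the leaves x and z: the number of pegged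
-- leaves never changes. A one-hole start on n ≥ 4 vertices has at least two
-- pegged leaves, whereas a one-peg configuration has at most one.
module Submission where

open import Defs
open import Data.Nat using (ℕ; suc; _+_; _≤_; s≤s; z≤n)
open import Data.Fin using (Fin; zero; suc; _≟_)
open import Data.Fin.Patterns using (1F; 2F; 3F)
open import Data.Bool using (true; false)
open import Data.Product using (_×_; _,_)
open import Data.Sum using (inj₁; inj₂)
open import Data.Empty using (⊥-elim)
open import Relation.Nullary using (¬_; Dec; yes; no)
open import Relation.Binary.PropositionalEquality using (_≡_; _≢_; refl; sym; trans; ≢-sym)
open import Relation.Binary.Construct.Closure.ReflexiveTransitive using (ε; _◅_)

record PegPairOff {n : ℕ} (o : Fin n) (c : Config n) : Set where
  field
    {a b} : Fin n
    a≢o   : a ≢ o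
    b≢o   : b ≢ o
    a≢b   : a ≢ b
    peg-a : c a ≡ true
    peg-b : c b ≡ true

peg≢hole : ∀ {n} {c : Config n} {p q : Fin n} → c p ≡ true → c q ≡ false → p ≢ q
peg≢hole cp cq refl with trans (sym cp) cq
... | ()

onePeg⇒¬PegPairOff : ∀ {n} {o p : Fin n} {c : Config n} → onePeg p c → ¬ PegPairOff o c
onePeg⇒¬PegPairOff {p = p} {c} (_ , holes)
  record { a = a ; b = b ; a≢b = a≢b ; peg-a = peg-a ; peg-b = peg-b } with a ≟ p
... | yes refl = peg≢hole {c = c} peg-b (holes b (≢-sym a≢b)) refl
... | no a≢p   = peg≢hole {c = c} peg-a (holes a a≢p) refl

-- A peg leaves u and a new one appears at w ≢ o; at worst the pair loses u and gains w.
pegPairOff-shift : ∀ {n} {o u w : Fin n} {c c′ : Config n} →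
  w ≢ o → c w ≡ false → c′ w ≡ true →
  (∀ v → v ≢ u → v ≢ o → v ≢ w → c′ v ≡ c v) →
  PegPairOff o c → PegPairOff o c′
pegPairOff-shift {o = o} {u} {w} {c} {c′} w≢o hole-w peg-w′ rest pair = shifted (a ≟ u) (b ≟ u)
  where
  open PegPairOff pair

  kept : ∀ {v} → v ≢ u → v ≢ o → c v ≡ true → c′ v ≡ true
  kept v≢u v≢o peg = trans (rest _ v≢u v≢o (peg≢hole {c = c} peg hole-w)) peg

  shifted : Dec (a ≡ u) → Dec (b ≡ u) → PegPairOff o c′
  shifted (yes a≡u) _ = record
    { a≢o = w≢o ; b≢o = b≢o ; a≢b = ≢-sym (peg≢hole {c = c} peg-b hole-w)
    ; peg-a = peg-w′ ; peg-b = kept (λ b≡u → a≢b (trans a≡u (sym b≡u))) b≢o peg-b }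
  shifted (no a≢u) (yes _) = record
    { a≢o = a≢o ; b≢o = w≢o ; a≢b = peg≢hole {c = c} peg-a hole-w
    ; peg-a = kept a≢u a≢o peg-a ; peg-b = peg-w′ }
  shifted (no a≢u) (no b≢u) = record
    { a≢o = a≢o ; b≢o = b≢o ; a≢b = a≢b
    ; peg-a = kept a≢u a≢o peg-a ; peg-b = kept b≢u b≢o peg-b }

star-path-centred : ∀ {m} {x y z : Fin (suc m)} → IsPath (K1 m) x y z →
  y ≡ zero × x ≢ zero × z ≢ zero
star-path-centred {x = suc _} {zero}  {suc _} _ = refl , (λ ()) , (λ ())
star-path-centred {x = zero}  {zero}  {_}     p = ⊥-elim (IsPath.xy p)
star-path-centred {x = _}     {zero}  {zero}  p = ⊥-elim (IsPath.yz p)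
star-path-centred {x = zero}  {suc _} {zero}  p = ⊥-elim (IsPath.x≢z p refl)
star-path-centred {x = zero}  {suc _} {suc _} p = ⊥-elim (IsPath.yz p)
star-path-centred {x = suc _} {suc _} {_}     p = ⊥-elim (IsPath.xy p)

star-move-pegPairOff : ∀ {m} {c c′ : Config (suc m)} →
  Move (K1 m) c c′ → PegPairOff zero c → PegPairOff zero c′
star-move-pegPairOff (inj₁ (_ , _ , _ , path , _ , _ , hole-z , upd)) with star-path-centred path
... | refl , _ , z≢0 = pegPairOff-shift z≢0 hole-z (Update.atz upd) (Update.rest upd)
star-move-pegPairOff (inj₂ (_ , _ , _ , path , hole-x , _ , _ , upd)) with star-path-centred path
... | refl , x≢0 , _ = pegPairOff-shift x≢0 hole-x (Update.atx upd)
  (λ v v≢z v≢y v≢x → Update.rest upd v v≢x v≢y v≢z)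

star-reachable-pegPairOff : ∀ {m} {c c′ : Config (suc m)} →
  Reachable (K1 m) c c′ → PegPairOff zero c → PegPairOff zero c′
star-reachable-pegPairOff ε           pair = pair
star-reachable-pegPairOff (move ◅ ms) pair =
  star-reachable-pegPairOff ms (star-move-pegPairOff move pair)

-- Among the leaves 1, 2, 3 at most one is the hole.
oneHole⇒pegPairOff : ∀ {k} {h : Fin (4 + k)} {c : Config (4 + k)} →
  oneHole h c → PegPairOff zero c
oneHole⇒pegPairOff {h = h} (_ , pegs) with h ≟ 1F | h ≟ 2F
... | yes refl | _ = record
  { a = 2F ; b = 3F ; a≢o = λ () ; b≢o = λ () ; a≢b = λ ()
  ; peg-a = pegs 2F (λ ()) ; peg-b = pegs 3F (λ ()) }
... | no _ | yes refl = record
  { a = 1F ; b = 3F ; a≢o = λ () ; b≢o = λ () ; a≢b = λ ()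
  ; peg-a = pegs 1F (λ ()) ; peg-b = pegs 3F (λ ()) }
... | no h≢1 | no h≢2 = record
  { a = 1F ; b = 2F ; a≢o = λ () ; b≢o = λ () ; a≢b = λ ()
  ; peg-a = pegs 1F (≢-sym h≢1) ; peg-b = pegs 2F (≢-sym h≢2) }

theorem1 : ∀ (n m : ℕ) → n ≡ suc m → 4 ≤ n → ¬ Solvable (K1 m)
theorem1 _ (suc (suc (suc _))) refl (s≤s (s≤s (s≤s (s≤s z≤n))))
  (_ , _ , oneHole-c₀ , _ , _ , onePeg-c₁ , c₀↝c₁) =
  onePeg⇒¬PegPairOff onePeg-c₁
    (star-reachable-pegPairOff c₀↝c₁ (oneHole⇒pegPairOff oneHole-c₀))
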